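{- Let $F:\mathbb{N}_0\to\mathbb{N}$ be a function, let $b\geq 2$ be an integer, and let $k$ be a fixed positive integer. Set $$s_k=\max\{F(0),F(1),F(2),\ldots,F(b^k-1)\},$$ i.e. the maximum of $F$ over all integers whose base-$b$ representation has at most $k$ digits (the largest being the $k$-digit number $\overline{(b-1)\cdots(b-1)}$). Consider the equation, in the unknowns $m\in\mathbb{N}$ (arbitrary positive integer) and integers $a_0,\dots,a_{km-1}$ with $0\le a_i\le b-1$ and $a_{km-1}\neq 0$, $$\sum_{i=0}^{km-1}a_ib^i=\sum_{i=0}^{m-1}F\big(\overline{a_{ki+k-1}\cdots a_{ki+1}a_{ki}}\big),$$ where $\overline{a_{ki+k-1}\cdots a_{ki}}=\sum_{j=0}^{k-1}a_{ki+j}b^j$. Then: (H) this equation has finitely many solutions. Moreover, every solution $n=\sum_{i=0}^{km-1}a_ib^i$ satisfies $n\leq b^{kM-1}$, where $M$ is given as follows: (1) if $k=1$ and $b=2$, then $M=\max\{7,s_1\}$; (2) if $k=1$ and $b=3$, then $M=\max\{4,s_1\}$; (3) if $k=1$ and $b=4$, then $M=\max\{3,s_1\}$; (4) if $k$ is arbitrary and $b\geq 5$, then $M=\max\{2,s_k\}$.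
   Context: $\mathbb{N}_0$ denotes the non-negative integers and $\mathbb{N}$ the positive integers. A natural number $n$ satisfying the displayed equation is called a base $b$ $k$-grouped $F$-Hardy's apology number: its base-$b$ digits are grouped into $m$ consecutive blocks of $k$ digits, and $n$ equals the sum of $F$ applied to the numbers formed by these blocks. The paper phrases the "moreover" part as: an algorithm finding all solutions only needs to check $n\le b^{kM-1}$. -}

module Defs where

open import Data.Nat using (ℕ; zero; suc; _+_; _*_; _∸_; _^_; _≤_; _<_; _⊔_)
open import Data.Product using (_×_)
open import Relation.Binary.PropositionalEquality using (_≡_; _≢_)

sumTo : ℕ → (ℕ → ℕ) → ℕ
sumTo zero    f = 0
sumTo (suc n) f = sumTo n f + f n

maxTo : ℕ → (ℕ → ℕ) → ℕ
maxTo zero    f = 0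
maxTo (suc n) f = maxTo n f ⊔ f n

sk : (F : ℕ → ℕ) (b k : ℕ) → ℕ
sk F b k = maxTo (b ^ k) F

value : (b k m : ℕ) (a : ℕ → ℕ) → ℕ
value b k m a = sumTo (k * m) (λ i → a i * b ^ i)

block : (b k : ℕ) (a : ℕ → ℕ) (i : ℕ) → ℕ
block b k a i = sumTo k (λ j → a (k * i + j) * b ^ j)

-- (m, a_0 … a_{km-1}) is a solution of the equation; entries a i with i ≥ km are irrelevant
IsSolution : (F : ℕ → ℕ) (b k m : ℕ) (a : ℕ → ℕ) → Set
IsSolution F b k m a =
  (1 ≤ m) ×
  (∀ i → i < k * m → a i < b) ×
  (a (k * m ∸ 1) ≢ 0) ×
  (value b k m a ≡ sumTo m (λ i → F (block b k a i)))

-- A solution with m blocks has a nonzero leading digit, so b^(km-1) ≤ n, and each block is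
-- below b^k, so n ≤ m·s_k. Hence if M ≥ s_k and x² ≤ b^(kx-1) for all x ≥ M, a solution with
-- m > M would give m² ≤ m·s_k, i.e. m ≤ s_k ≤ M; so m ≤ M and n ≤ M·M ≤ b^(kM-1).
-- The threshold max(7, s_k) works for every b ≥ 2, which gives finiteness; the sharper ones
-- come from x² ≤ c^(x-1) for x ≥ 4 (c = 3), x ≥ 3 (c = 4) and x ≥ 2 (c ≥ 5).
module Submission where

open import Defs
open import Data.Nat using (ℕ; zero; suc; _+_; _≤_; _<_; _*_; _∸_; _^_; _⊔_; z≤n; s≤s; _≤?_; _≤′_; ≤′-refl; ≤′-step; >-nonZero; ≢-nonZero)
open import Data.Nat.Properties
open import Data.Nat.Solver using (module +-*-Solver)
open import Data.Product using (_×_; Σ; _,_)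
open import Data.Sum using (inj₁; inj₂)
open import Data.List using (List; upTo)
open import Data.List.Membership.Propositional using (_∈_)
open import Data.List.Membership.Propositional.Properties using (∈-upTo⁺)
open import Relation.Nullary using (yes; no; contradiction)
open import Relation.Nullary.Decidable using (from-yes)
open import Relation.Binary.PropositionalEquality using (_≡_; refl; sym; trans)

open ≤-Reasoning

maxTo-upperBound : ∀ n (f : ℕ → ℕ) {y} → y < n → f y ≤ maxTo n f
maxTo-upperBound (suc n) f (s≤s y≤n) with m≤n⇒m<n∨m≡n y≤n
... | inj₁ y<n = ≤-trans (maxTo-upperBound n f y<n) (m≤m⊔n _ _)
... | inj₂ refl = m≤n⊔m _ _

sumTo-≤-* : ∀ m (f : ℕ → ℕ) s → (∀ i → i < m → f i ≤ s) → sumTo m f ≤ m * s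
sumTo-≤-* zero    f s f≤s = z≤n
sumTo-≤-* (suc m) f s f≤s = begin
  sumTo m f + f m ≤⟨ +-mono-≤ (sumTo-≤-* m f s (λ i i<m → f≤s i (m<n⇒m<1+n i<m))) (f≤s m ≤-refl) ⟩
  m * s + s       ≡⟨ +-comm (m * s) s ⟩
  suc m * s       ∎

sumTo-≥-last : ∀ n (f : ℕ → ℕ) → 1 ≤ n → f (n ∸ 1) ≤ sumTo n f
sumTo-≥-last (suc n) f _ = m≤n+m (f n) (sumTo n f)

sumTo-digits-<-^ : ∀ b k (d : ℕ → ℕ) → (∀ j → j < k → d j < b) → sumTo k (λ j → d j * b ^ j) < b ^ k
sumTo-digits-<-^ b zero    d d<b = s≤s z≤n
sumTo-digits-<-^ b (suc k) d d<b = begin-strict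
  sumTo k (λ j → d j * b ^ j) + d k * b ^ k
    <⟨ +-monoˡ-< (d k * b ^ k) (sumTo-digits-<-^ b k d (λ j j<k → d<b j (m<n⇒m<1+n j<k))) ⟩
  b ^ k + d k * b ^ k
    ≤⟨ *-monoˡ-≤ (b ^ k) (d<b k ≤-refl) ⟩
  b * b ^ k ∎

block-index-< : ∀ k {i j m} → i < m → j < k → k * i + j < k * m
block-index-< k {i} {j} {m} i<m j<k = begin-strict
  k * i + j     <⟨ +-monoʳ-< (k * i) j<k ⟩
  k * i + k     ≡⟨ trans (+-comm (k * i) k) (sym (*-suc k i)) ⟩
  k * suc i     ≤⟨ *-monoʳ-≤ k i<m ⟩
  k * m         ∎

value-≤-*-sk : ∀ {F b k m a} → IsSolution F b k m a → value b k m a ≤ m * sk F b k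
value-≤-*-sk {F} {b} {k} {m} {a} (_ , digit-< , _ , equation) = begin
  value b k m a                      ≡⟨ equation ⟩
  sumTo m (λ i → F (block b k a i))  ≤⟨ sumTo-≤-* m _ (sk F b k) F-block≤sk ⟩
  m * sk F b k                       ∎
  where
  block-<-^ : ∀ {i} → i < m → block b k a i < b ^ k
  block-<-^ {i} i<m =
    sumTo-digits-<-^ b k (λ j → a (k * i + j)) (λ j j<k → digit-< _ (block-index-< k i<m j<k))
  F-block≤sk : ∀ i → i < m → F (block b k a i) ≤ sk F b k
  F-block≤sk i i<m = maxTo-upperBound (b ^ k) F (block-<-^ i<m)

^-≤-value : ∀ {F b k m a} → 1 ≤ k → IsSolution F b k m a → b ^ (k * m ∸ 1) ≤ value b k m a
^-≤-value {F} {b} {k} {m} {a} k≥1 (m≥1 , _ , leading≢0 , _) = begin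
  b ^ (k * m ∸ 1)                    ≤⟨ m≤n*m (b ^ (k * m ∸ 1)) (a (k * m ∸ 1)) ⦃ ≢-nonZero leading≢0 ⦄ ⟩
  a (k * m ∸ 1) * b ^ (k * m ∸ 1)    ≤⟨ sumTo-≥-last (k * m) (λ i → a i * b ^ i) (*-mono-≤ k≥1 m≥1) ⟩
  value b k m a                      ∎

SquaresBelowPowers : (b k M : ℕ) → Set
SquaresBelowPowers b k M = ∀ x → M ≤ x → x * x ≤ b ^ (k * x ∸ 1)

solution-blocks-≤ : ∀ {F b k m a M} → 1 ≤ k → sk F b k ≤ M → SquaresBelowPowers b k M →
                    IsSolution F b k m a → m ≤ M
solution-blocks-≤ {F} {b} {k} {m} {a} {M} k≥1 sk≤M squares sol@(m≥1 , _) with m ≤? M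
... | yes m≤M = m≤M
... | no m≰M = contradiction m≤sk (<⇒≱ (≤-<-trans sk≤M M<m))
  where
  M<m = ≰⇒> m≰M
  m*m≤m*sk : m * m ≤ m * sk F b k
  m*m≤m*sk = begin
    m * m              ≤⟨ squares m (<⇒≤ M<m) ⟩
    b ^ (k * m ∸ 1)    ≤⟨ ^-≤-value {F = F} {k = k} {m = m} k≥1 sol ⟩
    value b k m a      ≤⟨ value-≤-*-sk {F = F} {k = k} {m = m} sol ⟩
    m * sk F b k       ∎
  m≤sk : m ≤ sk F b k
  m≤sk = *-cancelˡ-≤ m ⦃ >-nonZero m≥1 ⦄ m*m≤m*sk

solution-value-≤ : ∀ {F b k m a M} → 1 ≤ k → sk F b k ≤ M → SquaresBelowPowers b k M →
                   IsSolution F b k m a → value b k m a ≤ b ^ (k * M ∸ 1)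
solution-value-≤ {F} {b} {k} {m} {a} {M} k≥1 sk≤M squares sol = begin
  value b k m a      ≤⟨ value-≤-*-sk {F = F} {k = k} {m = m} sol ⟩
  m * sk F b k       ≤⟨ *-mono-≤ (solution-blocks-≤ k≥1 sk≤M squares sol) sk≤M ⟩
  M * M              ≤⟨ squares M ≤-refl ⟩
  b ^ (k * M ∸ 1)    ∎

suc-square-≤-double : ∀ x → 3 ≤ x → suc x * suc x ≤ 2 * (x * x)
suc-square-≤-double (suc (suc (suc z))) (s≤s (s≤s (s≤s _))) = begin
  (4 + z) * (4 + z)                              ≤⟨ m≤m+n _ (2 + 4 * z + z * z) ⟩
  (4 + z) * (4 + z) + (2 + 4 * z + z * z)        ≡⟨ identity z ⟩
  2 * ((3 + z) * (3 + z))                        ∎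
  where
  open +-*-Solver
  identity : ∀ z → (4 + z) * (4 + z) + (2 + 4 * z + z * z) ≡ 2 * ((3 + z) * (3 + z))
  identity = solve 1 (λ z → (con 4 :+ z) :* (con 4 :+ z) :+ (con 2 :+ con 4 :* z :+ z :* z)
                          := con 2 :* ((con 3 :+ z) :* (con 3 :+ z))) refl

square-≤-^-suc : ∀ {c} x → 2 ≤ c → 3 ≤ x → x * x ≤ c ^ (x ∸ 1) → suc x * suc x ≤ c ^ x
square-≤-^-suc {c} (suc y) c≥2 x≥3 sq≤ = begin
  suc (suc y) * suc (suc y)   ≤⟨ suc-square-≤-double (suc y) x≥3 ⟩
  2 * (suc y * suc y)         ≤⟨ *-mono-≤ c≥2 sq≤ ⟩
  c * c ^ y                   ∎

square-≤-^-from : ∀ {c T} → 2 ≤ c → 3 ≤ T → T * T ≤ c ^ (T ∸ 1) → ∀ x → T ≤ x → x * x ≤ c ^ (x ∸ 1)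
square-≤-^-from {c} {T} c≥2 T≥3 base x T≤x = go (≤⇒≤′ T≤x)
  where
  go : ∀ {x} → T ≤′ x → x * x ≤ c ^ (x ∸ 1)
  go ≤′-refl = base
  go (≤′-step {y} T≤′y) = square-≤-^-suc y c≥2 (≤-trans T≥3 (≤′⇒≤ T≤′y)) (go T≤′y)

square-≤-2^-from-7 : ∀ x → 7 ≤ x → x * x ≤ 2 ^ (x ∸ 1)
square-≤-2^-from-7 = square-≤-^-from ≤-refl (from-yes (3 ≤? 7)) (from-yes (49 ≤? 64))

square-≤-3^-from-4 : ∀ x → 4 ≤ x → x * x ≤ 3 ^ (x ∸ 1)
square-≤-3^-from-4 = square-≤-^-from (from-yes (2 ≤? 3)) (from-yes (3 ≤? 4)) (from-yes (16 ≤? 27))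

square-≤-4^-from-3 : ∀ x → 3 ≤ x → x * x ≤ 4 ^ (x ∸ 1)
square-≤-4^-from-3 = square-≤-^-from (from-yes (2 ≤? 4)) ≤-refl (from-yes (9 ≤? 16))

square-≤-^-from-2 : ∀ {c} → 5 ≤ c → ∀ x → 2 ≤ x → x * x ≤ c ^ (x ∸ 1)
square-≤-^-from-2 {c} c≥5 x x≥2 with ≤⇒≤′ x≥2
... | ≤′-refl = ≤-trans (from-yes (4 ≤? 5)) (≤-trans c≥5 (≤-reflexive (sym (*-identityʳ c))))
... | ≤′-step 2≤′y = square-≤-^-from (≤-trans (from-yes (2 ≤? 5)) c≥5) ≤-refl 9≤c² x (s≤s (≤′⇒≤ 2≤′y))
  where
  9≤c² : 3 * 3 ≤ c * (c * 1)
  9≤c² = ≤-trans (from-yes (9 ≤? 25)) (*-mono-≤ c≥5 (*-mono-≤ c≥5 ≤-refl))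

squaresBelowPowers-lift : ∀ {b k c T} → 2 ≤ b → 1 ≤ k → c ≤ b →
                          (∀ x → T ≤ x → x * x ≤ c ^ (x ∸ 1)) → SquaresBelowPowers b k T
squaresBelowPowers-lift {b} {k} {c} b≥2 k≥1 c≤b squares x T≤x = begin
  x * x             ≤⟨ squares x T≤x ⟩
  c ^ (x ∸ 1)       ≤⟨ ^-monoˡ-≤ (x ∸ 1) c≤b ⟩
  b ^ (x ∸ 1)       ≤⟨ ^-monoʳ-≤ b ⦃ >-nonZero (≤-trans (s≤s z≤n) b≥2) ⦄
                         (∸-monoˡ-≤ 1 (m≤n*m x k ⦃ >-nonZero k≥1 ⦄)) ⟩
  b ^ (k * x ∸ 1)   ∎

theorem2p3 : (F : ℕ → ℕ) → (∀ x → 1 ≤ F x) → (b k : ℕ) → 2 ≤ b → 1 ≤ k →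
    (Σ (List ℕ) (λ L → ∀ m a → IsSolution F b k m a → value b k m a ∈ L)) ×
    ((k ≡ 1 → b ≡ 2 → ∀ m a → IsSolution F b k m a → value b k m a ≤ b ^ (k * (7 ⊔ sk F b k) ∸ 1)) ×
     (k ≡ 1 → b ≡ 3 → ∀ m a → IsSolution F b k m a → value b k m a ≤ b ^ (k * (4 ⊔ sk F b k) ∸ 1)) ×
     (k ≡ 1 → b ≡ 4 → ∀ m a → IsSolution F b k m a → value b k m a ≤ b ^ (k * (3 ⊔ sk F b k) ∸ 1)) ×
     (5 ≤ b → ∀ m a → IsSolution F b k m a → value b k m a ≤ b ^ (k * (2 ⊔ sk F b k) ∸ 1)))
theorem2p3 F _ b k b≥2 k≥1 =
  (upTo (suc (b ^ (k * (7 ⊔ sk F b k) ∸ 1))) , λ m a sol → ∈-upTo⁺ (s≤s (bound₂ m a sol))) ,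
  (λ _ _ → bound₂) ,
  (λ _ b≡3 → bound (≤-reflexive (sym b≡3)) square-≤-3^-from-4) ,
  (λ _ b≡4 → bound (≤-reflexive (sym b≡4)) square-≤-4^-from-3) ,
  (λ b≥5 → bound ≤-refl (square-≤-^-from-2 b≥5))
  where
  bound : ∀ {c T} → c ≤ b → (∀ x → T ≤ x → x * x ≤ c ^ (x ∸ 1)) →
          ∀ m a → IsSolution F b k m a → value b k m a ≤ b ^ (k * (T ⊔ sk F b k) ∸ 1)
  bound {T = T} c≤b squares m a = solution-value-≤ k≥1 (m≤n⊔m T (sk F b k))
    (λ x T⊔sk≤x → squaresBelowPowers-lift b≥2 k≥1 c≤b squares x (≤-trans (m≤m⊔n T (sk F b k)) T⊔sk≤x))
  bound₂ : ∀ m a → IsSolution F b k m a → value b k m a ≤ b ^ (k * (7 ⊔ sk F b k) ∸ 1)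
  bound₂ = bound b≥2 square-≤-2^-from-7
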